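{- Let $t\ge2$ and consider an edge coloring of $K_n$ with colors $\{1,\ldots,t\}$, with color classes $H_1,\ldots,H_t$ (spanning subgraphs), such that $H_j$ is regular for every $j\geq 3$. Let $u,v,x_0$ be distinct vertices with $vx_{0}\in E(H_{1})$ and $x_{0}u\notin E(H_{1})$. If there is no $vx_0$ and $x_0u$ exchange, then every longest near exchange $(vx_{0},x_{0}u,\ldots,vx_{l-1},x_{l-1}u)$ using $vx_0$ and $x_0u$ has its last edge $x_{l-1}u$ in $E(H_{2})$.
   Context: For distinct vertices $u,v$ and vertex $x_0$, a $vx_0$ and $x_0u$ exchange is a list of $2l$ distinct edges $(vx_{0},x_{0}u,vx_{1},x_{1}u,\ldots,vx_{l-1},x_{l-1}u)$ of $K_n$ such that $x_{i}u$ and $vx_{i+1}$ have the same color for all $i$ modulo $l$. A near exchange of length $l$ using $vx_0$ and $x_0u$ is a list of $2l$ distinct edges $(vx_{0},x_{0}u,\ldots,vx_{l-1},x_{l-1}u)$ such that $x_iu$ and $vx_{i+1}$ have the same color for $0\le i\le l-2$, and $x_{j}u$ does not have the same color as $vx_{0}$ for every $j\leq l-1$. "Longest" means of maximum length $l$. -}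

module Defs where

open import Data.Nat using (ℕ; zero; suc; _≤_)
open import Data.Fin using (Fin; zero; suc; toℕ; inject₁; fromℕ; _≟_)
open import Data.List using (length; filter)
import Data.List.Base as LB
open import Data.Product using (_×_; _,_; Σ)
open import Data.Sum using (_⊎_)
open import Relation.Nullary using (¬_)
open import Relation.Nullary.Decidable using (_×-dec_; ¬?)
open import Relation.Binary.PropositionalEquality using (_≡_; _≢_)

-- An edge colouring of K_n with t colours is a
-- function c : Fin n → Fin n → Fin t that is symmetric; only the values
-- c a b with a ≢ b are meaningful (edge ab of K_n).
-- Colour "1" of the paper is `zero`, colour "2" is `suc zero`, and paper colour
-- j corresponds to the element of Fin t with toℕ = j - 1.

Colouring : ℕ → ℕ → Set
Colouring n t = Fin n → Fin n → Fin t

Symmetric : ∀ {n t} → Colouring n t → Set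
Symmetric {n} c = (a b : Fin n) → c a b ≡ c b a

degree : ∀ {n t} → Colouring n t → Fin t → Fin n → ℕ
degree {n} c j a =
  length (filter (λ b → ¬? (a ≟ b) ×-dec (c a b ≟ j)) (LB.allFin n))

Regular : ∀ {n t} → Colouring n t → Fin t → Set
Regular {n} c j = (a b : Fin n) → degree c j a ≡ degree c j b

SameEdge : ∀ {n} → (Fin n × Fin n) → (Fin n × Fin n) → Set
SameEdge (a , b) (c , d) = (a ≡ c × b ≡ d) ⊎ (a ≡ d × b ≡ c)

-- The list (v x_0, x_0 u, ..., v x_{l-1}, x_{l-1} u), with l = suc k,
-- given by x : Fin (suc k) → Fin n, consists of 2l distinct edges of K_n.
DistinctEdges : ∀ {n k} → Fin n → Fin n → (Fin (suc k) → Fin n) → Set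
DistinctEdges {n} {k} u v x =
  ((i : Fin (suc k)) → v ≢ x i × x i ≢ u)
  × ((i j : Fin (suc k)) → i ≢ j → ¬ SameEdge (v , x i) (v , x j))
  × ((i j : Fin (suc k)) → i ≢ j → ¬ SameEdge (x i , u) (x j , u))
  × ((i j : Fin (suc k)) → ¬ SameEdge (v , x i) (x j , u))

lastIx : ∀ k → Fin (suc k)
lastIx k = fromℕ k

Chain : ∀ {n t k} → Colouring n t → Fin n → Fin n → (Fin (suc k) → Fin n) → Set
Chain {k = k} c u v x = (i : Fin k) → c (x (inject₁ i)) u ≡ c v (x (suc i))

Exchange : ∀ {n t} → Colouring n t → Fin n → Fin n → Fin n → (k : ℕ) → (Fin (suc k) → Fin n) → Set
Exchange c u v x0 k x =
  x zero ≡ x0 × DistinctEdges u v x × Chain c u v x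
  × c (x (lastIx k)) u ≡ c v (x zero)

NearExchange : ∀ {n t} → Colouring n t → Fin n → Fin n → Fin n → (k : ℕ) → (Fin (suc k) → Fin n) → Set
NearExchange c u v x0 k x =
  x zero ≡ x0 × DistinctEdges u v x × Chain c u v x
  × ((j : Fin (suc k)) → c (x j) u ≢ c v (x zero))

LongestNearExchange : ∀ {n t} → Colouring n t → Fin n → Fin n → Fin n → (k : ℕ) → (Fin (suc k) → Fin n) → Set
LongestNearExchange {n} c u v x0 k x =
  NearExchange c u v x0 k x
  × ((k' : ℕ) (y : Fin (suc k') → Fin n) → NearExchange c u v x0 k' y → k' ≤ k)

-- Let J be the colour of the last edge x_{l-1}u; J is not colour 1 because the
-- near exchange is near.  Suppose J ≥ 3, so that H_J is regular.  A vertex w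
-- outside {u, v, x_0, …, x_{l-1}} with vw of colour J would continue the list by
-- (vw, wu): into an exchange if wu has colour 1, into a longer near exchange
-- otherwise.  Hence every J-neighbour of v is u or some x_{i+1}, and u ↦ v,
-- x_{i+1} ↦ x_i injects the J-neighbours of v into the J-neighbours of u while
-- missing x_{l-1}.  So deg_J v < deg_J u, contradicting regularity.
module Submission where

open import Defs
open import Data.Empty using (⊥-elim)
open import Data.Fin using (Fin; zero; suc; toℕ; inject₁; fromℕ; _≟_)
open import Data.Fin.Properties using (injective⇒≤; inject₁-injective; fromℕ≢inject₁; any?)
open import Data.Fin.Relation.Unary.Top using (View; view; ‵fromℕ; ‵inject₁; view-fromℕ; view-inject₁)
open import Data.List using (List; length; filter; lookup; allFin)
open import Data.List.Membership.Propositional.Properties using (∈-filter⁺; ∈-filter⁻; ∈-allFin; ∈-lookup)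
import Data.List.Relation.Unary.All as All
open import Data.List.Relation.Unary.AllPairs using (_∷_)
open import Data.List.Relation.Unary.Any using (index)
open import Data.List.Relation.Unary.Any.Properties using (lookup-index)
open import Data.List.Relation.Unary.Unique.Propositional using (Unique)
import Data.List.Relation.Unary.Unique.Propositional.Properties as Unique
open import Data.Nat using (ℕ; zero; suc; _≤_; _<_; z≤n; s≤s)
open import Data.Nat.Properties using (<-irrefl; 1+n≰n)
open import Data.Product using (Σ; _×_; _,_; proj₁; proj₂)
open import Data.Sum using (_⊎_; inj₁; inj₂)
open import Function.Base using (_∘_)
open import Function.Definitions using (Injective)
open import Level using (Level; 0ℓ)
open import Relation.Nullary using (¬_; yes; no)
open import Relation.Nullary.Decidable using (_×-dec_; ¬?)
open import Relation.Unary using (Pred; Decidable)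
open import Relation.Binary.PropositionalEquality using (_≡_; _≢_; refl; sym; trans; cong; subst)

private
  variable
    a ℓ : Level
    A : Set a
    m n t k : ℕ

lookup-injective : {xs : List A} → Unique xs → Injective _≡_ _≡_ (lookup xs)
lookup-injective (_ ∷ _)    {zero}  {zero}  _  = refl
lookup-injective (x∉ ∷ _)   {zero}  {suc j} eq = ⊥-elim (All.lookup x∉ (∈-lookup j) eq)
lookup-injective (x∉ ∷ _)   {suc i} {zero}  eq = ⊥-elim (All.lookup x∉ (∈-lookup i) (sym eq))
lookup-injective (_ ∷ uniq) {suc i} {suc j} eq = cong suc (lookup-injective uniq eq)

count : {P : Pred (Fin n) ℓ} → Decidable P → ℕ
count {n} P? = length (filter P? (allFin n))

module _ {P Q : Pred (Fin n) ℓ} (P? : Decidable P) (Q? : Decidable Q) where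

  injection⇒≤-count : (g : Fin m → Fin n) → Injective _≡_ _≡_ g → (∀ i → Q (g i))
    → m ≤ count Q?
  injection⇒≤-count {m} g g-inj Qg = injective⇒≤ {f = position} position-injective
    where
    position : Fin m → Fin (count Q?)
    position i = index (∈-filter⁺ Q? (∈-allFin (g i)) (Qg i))

    lookup-position : ∀ i → g i ≡ lookup (filter Q? (allFin n)) (position i)
    lookup-position i = lookup-index (∈-filter⁺ Q? (∈-allFin (g i)) (Qg i))

    position-injective : Injective _≡_ _≡_ position
    position-injective {i} {j} eq = g-inj (trans (lookup-position i)
      (trans (cong (lookup (filter Q? (allFin n))) eq) (sym (lookup-position j))))

  count-< : (f : ∀ {b} → P b → Fin n) → (∀ {b} (p : P b) → Q (f p))
    → (∀ {b b′} (p : P b) (p′ : P b′) → f p ≡ f p′ → b ≡ b′)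
    → (e : Fin n) → Q e → (∀ {b} (p : P b) → f p ≢ e)
    → count P? < count Q?
  count-< f Qf f-inj e Qe f≢e = injection⇒≤-count g g-inj Qg
    where
    P-lookup : ∀ i → P (lookup (filter P? (allFin n)) i)
    P-lookup i = proj₂ (∈-filter⁻ P? {xs = allFin n} (∈-lookup i))

    g : Fin (suc (count P?)) → Fin n
    g zero    = e
    g (suc i) = f (P-lookup i)

    g-inj : Injective _≡_ _≡_ g
    g-inj {zero}  {zero}  _  = refl
    g-inj {zero}  {suc j} eq = ⊥-elim (f≢e (P-lookup j) (sym eq))
    g-inj {suc i} {zero}  eq = ⊥-elim (f≢e (P-lookup i) eq)
    g-inj {suc i} {suc j} eq =
      cong suc (lookup-injective (Unique.filter⁺ P? (Unique.allFin⁺ n)) (f-inj _ _ eq))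

    Qg : ∀ i → Q (g i)
    Qg zero    = Qe
    Qg (suc i) = Qf (P-lookup i)

_∷ʳ_ : (Fin m → A) → A → Fin (suc m) → A
(f ∷ʳ y) i with view i
... | ‵fromℕ     = y
... | ‵inject₁ j = f j

∷ʳ-inject₁ : (f : Fin m → A) (y : A) (i : Fin m) → (f ∷ʳ y) (inject₁ i) ≡ f i
∷ʳ-inject₁ f y i rewrite view-inject₁ i = refl

∷ʳ-fromℕ : (f : Fin m → A) (y : A) → (f ∷ʳ y) (fromℕ m) ≡ y
∷ʳ-fromℕ {m} f y rewrite view-fromℕ m = refl

∷ʳ-all : {f : Fin m → A} {y : A} {P : A → Set ℓ}
  → (∀ i → P (f i)) → P y → ∀ i → P ((f ∷ʳ y) i)
∷ʳ-all {f = f} {y} {P} Pf Py i = go (view i)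
  where
  go : ∀ {i} → View i → P ((f ∷ʳ y) i)
  go ‵fromℕ        = subst P (sym (∷ʳ-fromℕ f y)) Py
  go (‵inject₁ j) = subst P (sym (∷ʳ-inject₁ f y j)) (Pf j)

∷ʳ-injective : {f : Fin m → A} {y : A} → Injective _≡_ _≡_ f → (∀ i → y ≢ f i)
  → Injective _≡_ _≡_ (f ∷ʳ y)
∷ʳ-injective {m} {f = f} {y} f-inj y∉f {i} {j} = go (view i) (view j)
  where
  go : ∀ {i j : Fin (suc m)} → View i → View j → (f ∷ʳ y) i ≡ (f ∷ʳ y) j → i ≡ j
  go ‵fromℕ        ‵fromℕ        _  = refl
  go ‵fromℕ        (‵inject₁ j) eq =
    ⊥-elim (y∉f j (trans (sym (∷ʳ-fromℕ f y)) (trans eq (∷ʳ-inject₁ f y j))))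
  go (‵inject₁ i) ‵fromℕ        eq =
    ⊥-elim (y∉f i (trans (sym (∷ʳ-fromℕ f y)) (trans (sym eq) (∷ʳ-inject₁ f y i))))
  go (‵inject₁ i) (‵inject₁ j) eq =
    cong inject₁ (f-inj (trans (sym (∷ʳ-inject₁ f y i)) (trans eq (∷ʳ-inject₁ f y j))))

distinctEdges⇒injective : {u v : Fin n} {x : Fin (suc k) → Fin n}
  → DistinctEdges u v x → Injective _≡_ _≡_ x
distinctEdges⇒injective (_ , v-edges , _) {i} {j} xi≡xj with i ≟ j
... | yes i≡j = i≡j
... | no  i≢j = ⊥-elim (v-edges i j i≢j (inj₁ (refl , xi≡xj)))

injective⇒distinctEdges : {u v : Fin n} {x : Fin (suc k) → Fin n} → u ≢ v
  → (∀ i → v ≢ x i × x i ≢ u) → Injective _≡_ _≡_ x → DistinctEdges u v x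
injective⇒distinctEdges u≢v avoids x-inj = avoids
  , (λ i j i≢j → λ { (inj₁ (_ , xi≡xj)) → i≢j (x-inj xi≡xj)
                   ; (inj₂ (v≡xj , _))  → proj₁ (avoids j) v≡xj })
  , (λ i j i≢j → λ { (inj₁ (xi≡xj , _)) → i≢j (x-inj xi≡xj)
                   ; (inj₂ (xi≡u , _))  → proj₂ (avoids i) xi≡u })
  , (λ i j → λ { (inj₁ (v≡xj , _)) → proj₁ (avoids j) v≡xj
               ; (inj₂ (v≡u , _))  → u≢v (sym v≡u) })

Fresh : Fin n → Fin n → (Fin m → Fin n) → Fin n → Set
Fresh u v x w = w ≢ u × w ≢ v × (∀ i → w ≢ x i)

module _ (c : Colouring n t) {u v : Fin n} where

  Adjacent : Fin t → Fin n → Pred (Fin n) 0ℓ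
  Adjacent j a b = a ≢ b × c a b ≡ j

  -- count (adjacent? j a) unfolds to degree c j a.
  adjacent? : ∀ j a → Decidable (Adjacent j a)
  adjacent? j a b = ¬? (a ≟ b) ×-dec (c a b ≟ j)

  Continues : (Fin (suc k) → Fin n) → Fin n → Set
  Continues {k} x w = Fresh u v x w × c v w ≡ c (x (lastIx k)) u

  distinctEdges-∷ʳ : {x : Fin (suc k) → Fin n} {w : Fin n} → u ≢ v
    → DistinctEdges u v x → Fresh u v x w → DistinctEdges u v (x ∷ʳ w)
  distinctEdges-∷ʳ u≢v distinct (w≢u , w≢v , w∉x) =
    injective⇒distinctEdges u≢v
      (∷ʳ-all {P = λ z → v ≢ z × z ≢ u} (proj₁ distinct) (w≢v ∘ sym , w≢u))
      (∷ʳ-injective (distinctEdges⇒injective distinct) w∉x)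

  chain-∷ʳ : {x : Fin (suc k) → Fin n} {w : Fin n}
    → Chain c u v x → c (x (lastIx k)) u ≡ c v w → Chain c u v (x ∷ʳ w)
  chain-∷ʳ {k} {x} {w} chain links i = go (view i)
    where
    go : ∀ {i} → View i → c ((x ∷ʳ w) (inject₁ i)) u ≡ c v ((x ∷ʳ w) (suc i))
    go ‵fromℕ        rewrite ∷ʳ-inject₁ x w (fromℕ k) | ∷ʳ-fromℕ x w = links
    go (‵inject₁ j) rewrite ∷ʳ-inject₁ x w (inject₁ j) | ∷ʳ-inject₁ x w (suc j) = chain j

  nearExchange-∷ʳ : {x0 : Fin n} {x : Fin (suc k) → Fin n} {w : Fin n} → u ≢ v
    → NearExchange c u v x0 k x → Continues x w
    → Exchange c u v x0 (suc k) (x ∷ʳ w) ⊎ NearExchange c u v x0 (suc k) (x ∷ʳ w)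
  nearExchange-∷ʳ {x = x} {w} u≢v (x₀≡ , distinct , chain , near) (fresh , c-vw)
    with c w u ≟ c v (x zero)
  ... | yes closes = inj₁ (x₀≡ , distinctEdges-∷ʳ u≢v distinct fresh , chain-∷ʳ chain (sym c-vw)
    , subst (λ z → c z u ≡ c v (x zero)) (sym (∷ʳ-fromℕ x w)) closes)
  ... | no  opens  = inj₂ (x₀≡ , distinctEdges-∷ʳ u≢v distinct fresh , chain-∷ʳ chain (sym c-vw)
    , ∷ʳ-all {P = λ z → c z u ≢ c v (x zero)} near opens)

  longest⇒¬continues : {x0 : Fin n} {x : Fin (suc k) → Fin n} {w : Fin n} → u ≢ v
    → ¬ (Σ ℕ λ k → Σ (Fin (suc k) → Fin n) λ x → Exchange c u v x0 k x)
    → LongestNearExchange c u v x0 k x → ¬ Continues x w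
  longest⇒¬continues {k} {x = x} {w} u≢v noExchange (nearExchange , longest) continues
    with nearExchange-∷ʳ u≢v nearExchange continues
  ... | inj₁ exchange = noExchange (suc k , x ∷ʳ w , exchange)
  ... | inj₂ longer   = 1+n≰n (longest (suc k) (x ∷ʳ w) longer)

  ¬continues⇒degree-< : {x0 : Fin n} {x : Fin (suc k) → Fin n} → Symmetric c → u ≢ v
    → NearExchange c u v x0 k x → (∀ w → ¬ Continues x w)
    → degree c (c (x (lastIx k)) u) v < degree c (c (x (lastIx k)) u) u
  ¬continues⇒degree-< {k} {x = x} c-sym u≢v (_ , distinct , chain , near) stuck =
    count-< (adjacent? J v) (adjacent? J u) (previous ∘ locate)
      (λ p → adjacent-previous p (locate p)) (λ p p′ → previous-injective (locate p) (locate p′))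
      (x (lastIx k)) (proj₂ (avoids (lastIx k)) ∘ sym , c-sym u _) (previous≢last ∘ locate)
    where
    J : Fin t
    J = c (x (lastIx k)) u

    avoids : ∀ i → v ≢ x i × x i ≢ u
    avoids = proj₁ distinct

    x-inj : Injective _≡_ _≡_ x
    x-inj = distinctEdges⇒injective distinct

    OnExchange : Fin n → Set
    OnExchange b = b ≡ u ⊎ Σ (Fin k) λ i → b ≡ x (suc i)

    locate : ∀ {b} → Adjacent J v b → OnExchange b
    locate {b} (v≢b , c-vb) with b ≟ u | b ≟ v | any? (λ i → b ≟ x i)
    ... | yes b≡u | _       | _                 = inj₁ b≡u
    ... | no _    | yes b≡v | _                 = ⊥-elim (v≢b (sym b≡v))
    ... | no _    | no _    | yes (zero , b≡x₀) =
      ⊥-elim (near (lastIx k) (trans (sym c-vb) (cong (c v) b≡x₀)))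
    ... | no _    | no _    | yes (suc i , b≡x) = inj₂ (i , b≡x)
    ... | no b≢u  | no b≢v  | no b∉x            =
      ⊥-elim (stuck b ((b≢u , b≢v , λ i b≡xi → b∉x (i , b≡xi)) , c-vb))

    previous : ∀ {b} → OnExchange b → Fin n
    previous (inj₁ _)       = v
    previous (inj₂ (i , _)) = x (inject₁ i)

    adjacent-previous : ∀ {b} → Adjacent J v b → (p : OnExchange b) → Adjacent J u (previous p)
    adjacent-previous (_ , c-vb) (inj₁ refl)       = u≢v , trans (c-sym u v) c-vb
    adjacent-previous (_ , c-vb) (inj₂ (i , refl)) =
      proj₂ (avoids (inject₁ i)) ∘ sym , trans (c-sym u _) (trans (chain i) c-vb)

    previous-injective : ∀ {b b′} (p : OnExchange b) (p′ : OnExchange b′)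
      → previous p ≡ previous p′ → b ≡ b′
    previous-injective (inj₁ b≡u)      (inj₁ b′≡u)      _  = trans b≡u (sym b′≡u)
    previous-injective (inj₁ _)        (inj₂ (i , _))   eq =
      ⊥-elim (proj₁ (avoids (inject₁ i)) eq)
    previous-injective (inj₂ (i , _))  (inj₁ _)         eq =
      ⊥-elim (proj₁ (avoids (inject₁ i)) (sym eq))
    previous-injective (inj₂ (i , b≡)) (inj₂ (j , b′≡)) eq with inject₁-injective (x-inj eq)
    ... | refl = trans b≡ (sym b′≡)

    previous≢last : ∀ {b} (p : OnExchange b) → previous p ≢ x (lastIx k)
    previous≢last (inj₁ _)       = proj₁ (avoids (lastIx k))
    previous≢last (inj₂ (i , _)) = fromℕ≢inject₁ ∘ sym ∘ x-inj

≢zero∧≱2⇒≡suc-zero : {j : Fin (suc (suc m))} → j ≢ zero → ¬ (2 ≤ toℕ j) → j ≡ suc zero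
≢zero∧≱2⇒≡suc-zero {j = zero}        j≢0 _   = ⊥-elim (j≢0 refl)
≢zero∧≱2⇒≡suc-zero {j = suc zero}    _   _   = refl
≢zero∧≱2⇒≡suc-zero {j = suc (suc _)} _   j≱2 = ⊥-elim (j≱2 (s≤s (s≤s z≤n)))

lemma3p2 : (n t' : ℕ) (c : Colouring n (suc (suc t')))
    → Symmetric c
    → ((j : Fin (suc (suc t'))) → 2 ≤ toℕ j → Regular c j)
    → (u v x0 : Fin n) → u ≢ v → u ≢ x0 → v ≢ x0
    → c v x0 ≡ zero → c x0 u ≢ zero
    → ¬ (Σ ℕ λ k → Σ (Fin (suc k) → Fin n) λ x → Exchange c u v x0 k x)
    → (k : ℕ) (x : Fin (suc k) → Fin n) → LongestNearExchange c u v x0 k x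
    → c (x (lastIx k)) u ≡ suc zero
lemma3p2 n t' c c-sym regular u v x0 u≢v _ _ c-vx0 _ noExchange k x
         longest@(nearExchange , _) =
  ≢zero∧≱2⇒≡suc-zero last≢colour1 λ 2≤J →
    <-irrefl (regular J 2≤J v u) (¬continues⇒degree-< c c-sym u≢v nearExchange stuck)
  where
  J : Fin (suc (suc t'))
  J = c (x (lastIx k)) u

  last≢colour1 : J ≢ zero
  last≢colour1 J≡1 = proj₂ (proj₂ (proj₂ nearExchange)) (lastIx k)
    (trans J≡1 (sym (trans (cong (c v) (proj₁ nearExchange)) c-vx0)))

  stuck : ∀ w → ¬ Continues c x w
  stuck _ = longest⇒¬continues c u≢v noExchange longest
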